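{- For any connected outerplanar graph $G$, any vertex $v\in V(G)$, and any connected subgraph $H$ of $G$ with $v\in V(H)$, we have $\operatorname{ecc}^*_D(v,H)\le \operatorname{ecc}^*_D(v,G)$.
   Context: $D$ is a fixed positive integer. For a graph $G=(V,E)$, an outerplanar completion of $G$ is a graph $G'=(V,E\cup F)$, for some set $F$ of pairs of vertices non-adjacent in $G$, such that $G'$ is outerplanar; it is a diameter-$D$ outerplanar completion if it has diameter at most $D$. The eccentricity of $u$ in a graph $H$ is $\operatorname{ecc}(u,H)=\max_{w\in V(H)} \operatorname{dist}_H(u,w)$. For an outerplanar graph $G$ and $u\in V(G)$, $\operatorname{ecc}^*_D(u,G)$ is the minimum of $\operatorname{ecc}(u,H)$ over all diameter-$D$ outerplanar completions $H$ of $G$, and $\infty$ if $G$ has no such completion. -}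

module Defs where

open import Data.Nat using (ℕ; zero; suc; _≤_)
open import Data.Fin using (Fin) renaming (_<_ to _<ᶠ_)
open import Data.Bool using (Bool; true; false)
open import Data.Maybe using (Maybe; just; nothing)
open import Data.Product using (Σ; ∃; _×_; _,_)
open import Data.Empty using (⊥)
open import Relation.Nullary using (¬_)
open import Relation.Binary.PropositionalEquality using (_≡_)
open import Function.Definitions using (Injective)

record Graph (n : ℕ) : Set where
  field
    adj    : Fin n → Fin n → Bool
    sym    : ∀ a b → adj a b ≡ adj b a
    irrefl : ∀ a → adj a a ≡ false
open Graph public

Edge : ∀ {n} → Graph n → Fin n → Fin n → Set
Edge G a b = adj G a b ≡ true

-- Outerplanar: the vertices can be placed in convex position (on a circle,
-- positions given by an injective σ) so that no two edges (straight chords) cross.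
Outerplanar : ∀ {n} → Graph n → Set
Outerplanar {n} G =
  Σ (Fin n → Fin n) λ σ → Injective _≡_ _≡_ σ ×
    (∀ a b c d → Edge G a b → Edge G c d →
       ¬ (σ a <ᶠ σ c × σ c <ᶠ σ b × σ b <ᶠ σ d))

-- Reach G u w k : there is a walk from u to w of length at most k,
-- i.e. dist_G(u,w) ≤ k.
data Reach {n} (G : Graph n) : Fin n → Fin n → ℕ → Set where
  here : ∀ {u k} → Reach G u u k
  step : ∀ {u x w k} → Edge G u x → Reach G x w k → Reach G u w (suc k)

Connected : ∀ {n} → Graph n → Set
Connected {n} G = ∀ (u w : Fin n) → ∃ λ k → Reach G u w k

DiamLE : ∀ {n} → ℕ → Graph n → Set
DiamLE {n} D G = ∀ (u w : Fin n) → Reach G u w D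

IsEcc : ∀ {n} → Graph n → Fin n → ℕ → Set
IsEcc {n} G u k =
  (∀ w → Reach G u w k) × (∀ j → (∀ w → Reach G u w j) → k ≤ j)

OuterplanarCompletion : ∀ {n} → Graph n → Graph n → Set
OuterplanarCompletion G G' = (∀ a b → Edge G a b → Edge G' a b) × Outerplanar G'

DiamCompletion : ∀ {n} → ℕ → Graph n → Graph n → Set
DiamCompletion D G G' = OuterplanarCompletion G G' × DiamLE D G'

-- IsEccStar D G u e : ecc*_D(u,G) = e, where nothing stands for ∞.
IsEccStar : ∀ {n} → ℕ → Graph n → Fin n → Maybe ℕ → Set
IsEccStar {n} D G u (just k) =
  (Σ (Graph n) λ G' → DiamCompletion D G G' × IsEcc G' u k) ×
  (∀ (G' : Graph n) → DiamCompletion D G G' → ∀ j → IsEcc G' u j → k ≤ j)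
IsEccStar {n} D G u nothing = ∀ (G' : Graph n) → ¬ DiamCompletion D G G'

data _≤∞_ : Maybe ℕ → Maybe ℕ → Set where
  fin≤fin : ∀ {a b} → a ≤ b → just a ≤∞ just b
  _≤inf   : ∀ a → a ≤∞ nothing

SubgraphVia : ∀ {m n} → Graph m → Graph n → (Fin m → Fin n) → Set
SubgraphVia H G f =
  Injective _≡_ _≡_ f × (∀ a b → Edge H a b → Edge G (f a) (f b))

{-# OPTIONS --safe #-}

-- Let G' be a diameter-D outerplanar completion of G realising ecc*_D(v, G). A multi-source
-- breadth-first search from the image of H partitions V(G') into classes, one for each vertex a
-- of H, each connected in G' and containing a. Contracting the classes gives a graph H' on V(H)
-- that contains H; contraction does not increase distances, so H' has diameter at most D and
-- ecc(v, H') ≤ ecc(v, G'). H' is outerplanar for the circular order that G' induces on V(H):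
-- two crossing edges ab, cd of H' would yield vertex-disjoint walks a → b and c → d in G' with
-- interleaved endpoints, which a non-crossing convex drawing rules out by a parity argument.
module Submission where

open import Defs
open import Data.Nat using (ℕ; NonZero)
open import Data.Fin using (Fin)
open import Data.Maybe using (Maybe)
open import Relation.Binary.PropositionalEquality using (_≡_)

open import Data.Bool using (Bool; true; false; _xor_) renaming (_≟_ to _≟ᵇ_)
open import Data.Bool.Properties using (xor-assoc; xor-comm; xor-same)
open import Data.Empty using (⊥-elim)
open import Data.Fin using (toℕ; fromℕ<) renaming (_≟_ to _≟ᶠ_)
open import Data.Fin.Properties using (any?; all?; toℕ-injective; toℕ-fromℕ<)
open import Data.Fin.Subset using (Subset; _∈_; _⊂_; ⊤; ∣_∣)
open import Data.Fin.Subset.Properties using (∈⊤; ⊆⊤; ∣⊤∣≡n; p⊂q⇒∣p∣<∣q∣)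
open import Data.Maybe using (just; nothing; _<∣>_)
open import Data.Maybe.Properties using (just-injective) renaming (≡-dec to ≡-dec-Maybe)
open import Data.Nat using (suc; _<_; _≤_; z≤n; _<?_)
open import Data.Nat.Properties using (<-cmp; <-irrefl; <-asym; <-trans; <⇒≢; <⇒≯; ≤∧≢⇒<; ≤-trans)
open import Data.Product using (∃; ∃₂; _×_; _,_; proj₁; proj₂; swap)
open import Data.Sum using (_⊎_; inj₁; inj₂)
open import Data.Vec using (tabulate)
open import Data.Vec.Properties using (lookup∘tabulate; []=⇒lookup; lookup⇒[]=)
open import Function using (_∘_; case_of_)
open import Function.Definitions using (Injective)
open import Relation.Binary using (tri<; tri≈; tri>)
open import Relation.Binary.Construct.Closure.ReflexiveTransitive as Star using (Star; ε; _◅_; _◅◅_; fold; reverse)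
open import Relation.Binary.PropositionalEquality using (refl; trans; cong; cong₂; subst; subst₂; _≢_; module ≡-Reasoning) renaming (sym to ≡-sym)
open import Relation.Nullary using (¬_; Dec; yes; no; does; _×-dec_; ¬?)
open import Relation.Nullary.Decidable using (dec-true; dec-false; does-⇔)
open import Function.Bundles using (mk⇔)

edge-sym : ∀ {n} (G : Graph n) {a b} → Edge G a b → Edge G b a
edge-sym G {a} {b} e = trans (≡-sym (sym G a b)) e

edge-irrefl : ∀ {n} (G : Graph n) {a b} → Edge G a b → a ≢ b
edge-irrefl G {a} e refl with () ← trans (≡-sym e) (irrefl G a)

does-true⇒ : ∀ {A : Set} (a? : Dec A) → does a? ≡ true → A
does-true⇒ (yes a) _ = a

xor-telescope : ∀ a b c → (a xor b) xor (b xor c) ≡ a xor c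
xor-telescope a b c = begin
  (a xor b) xor (b xor c) ≡⟨ xor-assoc a b (b xor c) ⟩
  a xor (b xor (b xor c)) ≡⟨ cong (a xor_) (≡-sym (xor-assoc b b c)) ⟩
  a xor ((b xor b) xor c) ≡⟨ cong (λ t → a xor (t xor c)) (xor-same b) ⟩
  a xor c                 ∎
  where open ≡-Reasoning

<∣>-just⁻ : ∀ {A : Set} {a : A} mx my → (mx <∣> my) ≡ just a → mx ≡ just a ⊎ my ≡ just a
<∣>-just⁻ (just _) _ eq = inj₁ eq
<∣>-just⁻ nothing  _ eq = inj₂ eq

<∣>-defined : ∀ {A : Set} {a : A} mx {my} → my ≡ just a → ∃ λ b → (mx <∣> my) ≡ just b
<∣>-defined (just b) _  = b , refl
<∣>-defined nothing  eq = _ , eq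

reach-suc : ∀ {n} {G : Graph n} {u w k} → Reach G u w k → Reach G u w (suc k)
reach-suc here = here
reach-suc (step e r) = step e (reach-suc r)

reach? : ∀ {n} (G : Graph n) u w k → Dec (Reach G u w k)
reach? G u w k with u ≟ᶠ w
reach? G u w k       | yes refl = yes here
reach? G u w 0       | no u≢w = no λ { here → u≢w refl }
reach? G u w (suc k) | no u≢w with any? (λ x → (adj G u x ≟ᵇ true) ×-dec reach? G x w k)
... | yes (x , e , r) = yes (step e r)
... | no ¬step = no λ { here → u≢w refl ; (step e r) → ¬step (_ , e , r) }

Least : (ℕ → Set) → ℕ → Set
Least P j = P j × (∀ i → P i → j ≤ i)

module _ {P : ℕ → Set} (P? : ∀ j → Dec (P j)) where

  private
    least-or-bound : ∀ n → ∃ (Least P) ⊎ (∀ i → P i → n ≤ i)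
    least-or-bound 0 = inj₂ (λ _ _ → z≤n)
    least-or-bound (suc n) with least-or-bound n
    ... | inj₁ least = inj₁ least
    ... | inj₂ bound with P? n
    ...   | yes pn = inj₁ (n , pn , bound)
    ...   | no ¬pn = inj₂ (λ i pi → ≤∧≢⇒< (bound i pi) λ { refl → ¬pn pi })

  least : ∀ {k} → P k → ∃ (Least P)
  least {k} pk with least-or-bound (suc k)
  ... | inj₁ l = l
  ... | inj₂ bound = ⊥-elim (<-irrefl refl (bound k pk))

ecc-exists : ∀ {n} (G : Graph n) u {k} → (∀ w → Reach G u w k) → ∃ λ j → IsEcc G u j × j ≤ k
ecc-exists G u bound with least (λ j → all? λ w → reach? G u w j) bound
... | j , ecc@(_ , minimal) = j , ecc , minimal _ bound

ecc*-≤-completion : ∀ {D m} {H H' : Graph m} {u e k} → IsEccStar D H u e →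
                    DiamCompletion D H H' → (∀ w → Reach H' u w k) → e ≤∞ just k
ecc*-≤-completion {e = nothing} no-completion completion _ = ⊥-elim (no-completion _ completion)
ecc*-≤-completion {H' = H'} {u} {e = just _} (_ , minimal) completion bound with ecc-exists H' u bound
... | j , ecc , j≤k = fin≤fin (≤-trans (minimal _ completion j ecc) j≤k)

EdgeWithin : ∀ {n} → Graph n → (Fin n → Set) → Fin n → Fin n → Set
EdgeWithin G A x y = A x × A y × Edge G x y

edgeWithin-mono : ∀ {n} {G : Graph n} {A B : Fin n → Set} → (∀ {z} → A z → B z) →
                  ∀ {x y} → EdgeWithin G A x y → EdgeWithin G B x y
edgeWithin-mono A⊆B (ax , ay , e) = A⊆B ax , A⊆B ay , e

edgeWithin-sym : ∀ {n} {G : Graph n} {A : Fin n → Set} {x y} →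
                 EdgeWithin G A x y → EdgeWithin G A y x
edgeWithin-sym {G = G} (ax , ay , e) = ay , ax , edge-sym G e

WalkWithin : ∀ {n} → Graph n → (Fin n → Set) → Fin n → Fin n → Set
WalkWithin G A = Star (EdgeWithin G A)

-- Outerplanar G unfolds to an injective σ : Fin n → Fin n with NonCrossing G (toℕ ∘ σ).
NonCrossing : ∀ {n} → Graph n → (Fin n → ℕ) → Set
NonCrossing G pos =
  ∀ a b c d → Edge G a b → Edge G c d → ¬ (pos a < pos c × pos c < pos b × pos b < pos d)

module ConvexDrawing {n} {G : Graph n} {pos : Fin n → ℕ}
         (pos-injective : Injective _≡_ _≡_ pos) (noncrossing : NonCrossing G pos) where

  _≺_ : Fin n → Fin n → Bool
  z ≺ p = does (pos z <? pos p)

  -- For z ∉ {p, q}, side p q z says whether z lies strictly between p and q. Being an xor of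
  -- a potential, it telescopes along walks.
  side : Fin n → Fin n → Fin n → Bool
  side p q z = (z ≺ p) xor (z ≺ q)

  Inside Outside : Fin n → Fin n → Fin n → Set
  Inside p q z = pos p < pos z × pos z < pos q
  Outside p q z = pos z < pos p ⊎ pos q < pos z

  side-inside : ∀ {p q z} → Inside p q z → side p q z ≡ true
  side-inside {p} {q} {z} (pz , zq)
    rewrite dec-false (pos z <? pos p) (<⇒≯ pz) | dec-true (pos z <? pos q) zq = refl

  side-outside : ∀ {p q z} → pos p < pos q → Outside p q z → side p q z ≡ false
  side-outside {p} {q} {z} pq (inj₁ zp)
    rewrite dec-true (pos z <? pos p) zp | dec-true (pos z <? pos q) (<-trans zp pq) = refl
  side-outside {p} {q} {z} pq (inj₂ qz)
    rewrite dec-false (pos z <? pos p) (<⇒≯ (<-trans pq qz))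
          | dec-false (pos z <? pos q) (<⇒≯ qz) = refl

  locate : ∀ {p q z} → pos p < pos q → z ≢ p → z ≢ q → Inside p q z ⊎ Outside p q z
  locate {p} {q} {z} pq z≢p z≢q with <-cmp (pos z) (pos p) | <-cmp (pos z) (pos q)
  ... | tri< zp _ _ | _           = inj₂ (inj₁ zp)
  ... | tri≈ _ zp _ | _           = ⊥-elim (z≢p (pos-injective zp))
  ... | tri> _ _ pz | tri< zq _ _ = inj₁ (pz , zq)
  ... | tri> _ _ _  | tri≈ _ zq _ = ⊥-elim (z≢q (pos-injective zq))
  ... | tri> _ _ _  | tri> _ _ qz = inj₂ (inj₂ qz)

  no-edge-leaves-chord : ∀ {p q u v} → Edge G p q → Edge G u v → Inside p q u → ¬ Outside p q v
  no-edge-leaves-chord {p} {q} {u} {v} epq euv (pu , uq) (inj₁ vp) =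
    noncrossing v u p q (edge-sym G euv) epq (vp , pu , uq)
  no-edge-leaves-chord {p} {q} {u} {v} epq euv (pu , uq) (inj₂ qv) =
    noncrossing p q u v epq euv (pu , uq , qv)

  Avoids : Fin n → Fin n → Fin n → Set
  Avoids p q z = z ≢ p × z ≢ q

  side-sym : ∀ p q z → side p q z ≡ side q p z
  side-sym p q z = xor-comm (z ≺ p) (z ≺ q)

  side-along-edge< : ∀ {p q u v} → pos p < pos q → Edge G p q → Edge G u v →
                     Avoids p q u → Avoids p q v → side p q u ≡ side p q v
  side-along-edge< pq epq euv (u≢p , u≢q) (v≢p , v≢q) with locate pq u≢p u≢q | locate pq v≢p v≢q
  ... | inj₁ iu | inj₁ iv = trans (side-inside iu) (≡-sym (side-inside iv))
  ... | inj₂ ou | inj₂ ov = trans (side-outside pq ou) (≡-sym (side-outside pq ov))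
  ... | inj₁ iu | inj₂ ov = ⊥-elim (no-edge-leaves-chord epq euv iu ov)
  ... | inj₂ ou | inj₁ iv = ⊥-elim (no-edge-leaves-chord epq (edge-sym G euv) iv ou)

  side-along-edge : ∀ {p q u v} → Edge G p q → Edge G u v → Avoids p q u → Avoids p q v →
                    side p q u ≡ side p q v
  side-along-edge {p} {q} {u} {v} epq euv au av with <-cmp (pos p) (pos q)
  ... | tri< pq _ _ = side-along-edge< pq epq euv au av
  ... | tri≈ _ pq _ = ⊥-elim (edge-irrefl G epq (pos-injective pq))
  ... | tri> _ _ qp = begin
    side p q u ≡⟨ side-sym p q u ⟩
    side q p u ≡⟨ side-along-edge< qp (edge-sym G epq) euv (swap au) (swap av) ⟩
    side q p v ≡⟨ side-sym q p v ⟩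
    side p q v ∎
    where open ≡-Reasoning

  side-along-walk : ∀ {p q A u w} → Edge G p q → (∀ {z} → A z → Avoids p q z) →
                    WalkWithin G A u w → side p q u ≡ side p q w
  side-along-walk {p} {q} epq avoid =
    fold (λ u w → side p q u ≡ side p q w)
         (λ (au , av , euv) → trans (side-along-edge epq euv (avoid au) (avoid av)))
         refl

  side-telescope : ∀ {E : Fin n → Fin n → Set} {u w} → (∀ {x y} → E x y → side x y u ≡ side x y w) →
                   ∀ {p q} → Star E p q → side p q u ≡ side p q w
  side-telescope {E} {u} {w} along-edge =
    fold (λ p q → side p q u ≡ side p q w) extend
         λ {p} → trans (xor-same (u ≺ p)) (≡-sym (xor-same (w ≺ p)))
    where
    open ≡-Reasoning
    extend : ∀ {x y r} → E x y → side y r u ≡ side y r w → side x r u ≡ side x r w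
    extend {x} {y} {r} exy eq = begin
      side x r u                ≡⟨ ≡-sym (xor-telescope (u ≺ x) (u ≺ y) (u ≺ r)) ⟩
      side x y u xor side y r u ≡⟨ cong₂ _xor_ (along-edge exy) eq ⟩
      side x y w xor side y r w ≡⟨ xor-telescope (w ≺ x) (w ≺ y) (w ≺ r) ⟩
      side x r w                ∎

  -- No chord xy of the first walk separates u from w, as the second walk joins them avoiding x
  -- and y; telescoping, neither does the chord pq, although u lies between p and q and w does not.
  disjoint-walks-not-interleaved : ∀ {A B p q u w} → (∀ {z} → A z → ¬ B z) →
    WalkWithin G A p q → WalkWithin G B u w → ¬ (pos p < pos u × pos u < pos q × pos q < pos w)
  disjoint-walks-not-interleaved {A} {B} {p} {q} {u} {w} disjoint P Q (pu , uq , qw) =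
    case trans (≡-sym (side-inside (pu , uq)))
               (trans (side-telescope chord-keeps-sides P) (side-outside (<-trans pu uq) (inj₂ qw)))
    of λ ()
    where
    avoid : ∀ {x z} → A x → B z → z ≢ x
    avoid ax bz refl = disjoint ax bz
    chord-keeps-sides : ∀ {x y} → EdgeWithin G A x y → side x y u ≡ side x y w
    chord-keeps-sides (ax , ay , exy) = side-along-walk exy (λ bz → avoid ax bz , avoid ay bz) Q

module _ {m} {pos : Fin m → ℕ} (pos-injective : Injective _≡_ _≡_ pos) where

  private
    below : Fin m → Subset m
    below a = tabulate λ b → does (pos b <? pos a)

    ∈-below⁺ : ∀ {a b} → pos b < pos a → b ∈ below a
    ∈-below⁺ {a} {b} lt =
      lookup⇒[]= b (below a) (trans (lookup∘tabulate _ b) (dec-true (pos b <? pos a) lt))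

    ∈-below⁻ : ∀ {a b} → b ∈ below a → pos b < pos a
    ∈-below⁻ {a} {b} b∈ =
      does-true⇒ (pos b <? pos a) (trans (≡-sym (lookup∘tabulate _ b)) ([]=⇒lookup b∈))

    ∉-below-self : ∀ a → ¬ a ∈ below a
    ∉-below-self a a∈ = <-irrefl refl (∈-below⁻ a∈)

    below-⊂ : ∀ {a b} → pos a < pos b → below a ⊂ below b
    below-⊂ {a} ab = (λ c∈ → ∈-below⁺ (<-trans (∈-below⁻ c∈) ab)) , a , ∈-below⁺ ab , ∉-below-self a

    ∣below∣<m : ∀ a → ∣ below a ∣ < m
    ∣below∣<m a = subst (∣ below a ∣ <_) (∣⊤∣≡n m) (p⊂q⇒∣p∣<∣q∣ (⊆⊤ , a , ∈⊤ , ∉-below-self a))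

  rank : Fin m → Fin m
  rank a = fromℕ< (∣below∣<m a)

  rank-monotone : ∀ {a b} → pos a < pos b → toℕ (rank a) < toℕ (rank b)
  rank-monotone ab =
    subst₂ _<_ (≡-sym (toℕ-fromℕ< _)) (≡-sym (toℕ-fromℕ< _)) (p⊂q⇒∣p∣<∣q∣ (below-⊂ ab))

  rank-reflects : ∀ {a b} → toℕ (rank a) < toℕ (rank b) → pos a < pos b
  rank-reflects {a} {b} lt with <-cmp (pos a) (pos b)
  ... | tri< ab _ _ = ab
  ... | tri≈ _ ab _ with refl ← pos-injective ab = ⊥-elim (<-irrefl refl lt)
  ... | tri> _ _ ba = ⊥-elim (<-asym lt (rank-monotone ba))

  rank-injective : Injective _≡_ _≡_ rank
  rank-injective {a} {b} eq with <-cmp (pos a) (pos b)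
  ... | tri< ab _ _ = ⊥-elim (<⇒≢ (rank-monotone ab) (cong toℕ eq))
  ... | tri≈ _ ab _ = pos-injective ab
  ... | tri> _ _ ba = ⊥-elim (<⇒≢ (rank-monotone ba) (cong toℕ (≡-sym eq)))

noncrossing⇒outerplanar : ∀ {m} {G : Graph m} {pos} → Injective _≡_ _≡_ pos → NonCrossing G pos →
                          Outerplanar G
noncrossing⇒outerplanar pos-injective noncrossing =
  rank pos-injective , rank-injective pos-injective ,
  λ a b c d eab ecd (ac , cb , bd) →
    noncrossing a b c d eab ecd (rank-reflects pos-injective ac , rank-reflects pos-injective cb ,
                                 rank-reflects pos-injective bd)

module _ {n m} (G : Graph n) (R : Fin n → Fin m) where

  ContractedEdge : Fin m → Fin m → Set
  ContractedEdge a b = a ≢ b × ∃₂ λ x y → R x ≡ a × R y ≡ b × Edge G x y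

  private
    contracted-edge? : ∀ a b → Dec (ContractedEdge a b)
    contracted-edge? a b = ¬? (a ≟ᶠ b) ×-dec any? λ x → any? λ y →
      (R x ≟ᶠ a) ×-dec (R y ≟ᶠ b) ×-dec (adj G x y ≟ᵇ true)

    contracted-edge-sym : ∀ {a b} → ContractedEdge a b → ContractedEdge b a
    contracted-edge-sym (a≢b , x , y , Rx , Ry , e) = a≢b ∘ ≡-sym , y , x , Ry , Rx , edge-sym G e

  contract : Graph m
  contract = record
    { adj    = λ a b → does (contracted-edge? a b)
    ; sym    = λ a b → does-⇔ (mk⇔ contracted-edge-sym contracted-edge-sym)
                                (contracted-edge? a b) (contracted-edge? b a)
    ; irrefl = λ a → dec-false (contracted-edge? a a) λ (a≢a , _) → a≢a refl
    }

  contract-edge : ∀ {a b} → ContractedEdge a b → Edge contract a b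
  contract-edge {a} {b} = dec-true (contracted-edge? a b)

  contract-edge⁻ : ∀ {a b} → Edge contract a b → ContractedEdge a b
  contract-edge⁻ {a} {b} = does-true⇒ (contracted-edge? a b)

  reach-contract : ∀ {u w k} → Reach G u w k → Reach contract (R u) (R w) k
  reach-contract here = here
  reach-contract (step {u} {x} {w} {k} e r) with R u ≟ᶠ R x
  ... | yes Ru≡Rx =
    reach-suc (subst (λ t → Reach contract t (R w) k) (≡-sym Ru≡Rx) (reach-contract r))
  ... | no Ru≢Rx = step (contract-edge (Ru≢Rx , u , x , refl , refl , e)) (reach-contract r)

record Retraction {n m} (G : Graph n) (f : Fin m → Fin n) : Set where
  field
    retract         : Fin n → Fin m
    retract-section : ∀ a → retract (f a) ≡ a
    fibre-walk      : ∀ x → WalkWithin G (λ z → retract z ≡ retract x) x (f (retract x))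

module _ {n m} {G : Graph n} {f : Fin m → Fin n} (f-injective : Injective _≡_ _≡_ f) where

  private
    Labelling : Set
    Labelling = Fin n → Maybe (Fin m)

    FibresConnected : Labelling → Set
    FibresConnected ℓ = ∀ {x a} → ℓ x ≡ just a → WalkWithin G (λ z → ℓ z ≡ just a) x (f a)

    preimage : Labelling
    preimage x with any? (λ a → f a ≟ᶠ x)
    ... | yes (a , _) = just a
    ... | no _        = nothing

    preimage-image : ∀ a → preimage (f a) ≡ just a
    preimage-image a with any? (λ b → f b ≟ᶠ f a)
    ... | yes (b , fb≡fa) = cong just (f-injective fb≡fa)
    ... | no ∄b           = ⊥-elim (∄b (a , refl))

    preimage-fibres : FibresConnected preimage
    preimage-fibres {x} eq with any? (λ b → f b ≟ᶠ x)
    preimage-fibres refl | yes (_ , refl) = ε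

    LabelledNeighbour : Labelling → Fin n → Set
    LabelledNeighbour ℓ x = ∃₂ λ y a → Edge G x y × ℓ y ≡ just a

    labelled-neighbour? : ∀ ℓ x → Dec (LabelledNeighbour ℓ x)
    labelled-neighbour? ℓ x = any? λ y → any? λ a →
      (adj G x y ≟ᵇ true) ×-dec ≡-dec-Maybe _≟ᶠ_ (ℓ y) (just a)

    adopt : Labelling → Labelling
    adopt ℓ x with labelled-neighbour? ℓ x
    ... | yes (_ , a , _) = just a
    ... | no _            = nothing

    adopt-sound : ∀ {ℓ x a} → adopt ℓ x ≡ just a → ∃ λ y → Edge G x y × ℓ y ≡ just a
    adopt-sound {ℓ} {x} eq with labelled-neighbour? ℓ x
    adopt-sound refl | yes (y , _ , e , ℓy) = y , e , ℓy

    adopt-complete : ∀ {ℓ x} → LabelledNeighbour ℓ x → ∃ λ a → adopt ℓ x ≡ just a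
    adopt-complete {ℓ} {x} nb with labelled-neighbour? ℓ x
    ... | yes (_ , a , _) = a , refl
    ... | no ¬nb          = ⊥-elim (¬nb nb)

    grow : Labelling → Labelling
    grow ℓ x = ℓ x <∣> adopt ℓ x

    grow-extends : ∀ {ℓ x a} → ℓ x ≡ just a → grow ℓ x ≡ just a
    grow-extends eq rewrite eq = refl

    grow-fibres : ∀ {ℓ} → FibresConnected ℓ → FibresConnected (grow ℓ)
    grow-fibres {ℓ} fibres {x} eq with <∣>-just⁻ (ℓ x) (adopt ℓ x) eq
    ... | inj₁ ℓx = Star.map (edgeWithin-mono {G = G} grow-extends) (fibres ℓx)
    ... | inj₂ adopted with adopt-sound adopted
    ...   | y , exy , ℓy =
      (eq , grow-extends ℓy , exy) ◅ Star.map (edgeWithin-mono {G = G} grow-extends) (fibres ℓy)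

    -- Multi-source breadth-first search from the image of f: a vertex reached at stage k + 1
    -- adopts the label of a neighbour labelled at stage k, which keeps every label class connected.
    labels : ℕ → Labelling
    labels 0       = preimage
    labels (suc k) = grow (labels k)

    labels-image : ∀ k a → labels k (f a) ≡ just a
    labels-image 0       = preimage-image
    labels-image (suc k) a = grow-extends (labels-image k a)

    labels-fibres : ∀ k → FibresConnected (labels k)
    labels-fibres 0       = preimage-fibres
    labels-fibres (suc k) = grow-fibres (labels-fibres k)

    labels-cover : ∀ {k x a} → Reach G x (f a) k → ∃ λ b → labels k x ≡ just b
    labels-cover {k} {a = a} here = a , labels-image k a
    labels-cover {suc k} {x} (step e r) with labels-cover r
    ... | b , ℓy = <∣>-defined (labels k x) (proj₂ (adopt-complete (_ , b , e , ℓy)))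

  retraction : ∀ {k} → (∀ x → ∃ λ a → Reach G x (f a) k) → Retraction G f
  retraction {k} covered = record
    { retract         = R
    ; retract-section = λ a → just-injective (trans (≡-sym (labels-R (f a))) (labels-image k a))
    ; fibre-walk      = λ x → Star.map (edgeWithin-mono {G = G} label-R) (labels-fibres k (labels-R x))
    }
    where
    R : Fin n → Fin m
    R x = proj₁ (labels-cover (proj₂ (covered x)))
    labels-R : ∀ x → labels k x ≡ just (R x)
    labels-R x = proj₂ (labels-cover (proj₂ (covered x)))
    label-R : ∀ {z a} → labels k z ≡ just a → R z ≡ a
    label-R {z} ℓz = just-injective (trans (≡-sym (labels-R z)) ℓz)

module Contraction {n m} {G : Graph n} {f : Fin m → Fin n} (ρ : Retraction G f) where
  open Retraction ρ

  contracted : Graph m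
  contracted = contract G retract

  reach-between-images : ∀ {a b k} → Reach G (f a) (f b) k → Reach contracted a b k
  reach-between-images {a} {b} {k} r =
    subst₂ (λ s t → Reach contracted s t k) (retract-section a) (retract-section b)
      (reach-contract G retract r)

  private
    fibre-walk-to : ∀ {x a} → retract x ≡ a → WalkWithin G (λ z → retract z ≡ a) x (f a)
    fibre-walk-to {x} refl = fibre-walk x

  contracted-edge-walk : ∀ {a b} → Edge contracted a b →
                         WalkWithin G (λ z → retract z ≡ a ⊎ retract z ≡ b) (f a) (f b)
  contracted-edge-walk e with contract-edge⁻ G retract e
  ... | _ , x , y , Rx , Ry , exy =
    reverse (edgeWithin-sym {G = G}) (Star.map (edgeWithin-mono {G = G} inj₁) (fibre-walk-to Rx))
      ◅◅ (inj₁ Rx , inj₂ Ry , exy) ◅ Star.map (edgeWithin-mono {G = G} inj₂) (fibre-walk-to Ry)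

  contract-noncrossing : ∀ {pos} → Injective _≡_ _≡_ pos → NonCrossing G pos →
                         NonCrossing contracted (pos ∘ f)
  contract-noncrossing {pos} pos-injective noncrossing a b c d eab ecd (ac , cb , bd) =
    disjoint-walks-not-interleaved disjoint (contracted-edge-walk eab) (contracted-edge-walk ecd)
      (ac , cb , bd)
    where
    open ConvexDrawing {G = G} pos-injective noncrossing
    distinct : ∀ {s t} → pos (f s) < pos (f t) → s ≢ t
    distinct lt = <⇒≢ lt ∘ cong (pos ∘ f)
    disjoint : ∀ {z} → retract z ≡ a ⊎ retract z ≡ b → ¬ (retract z ≡ c ⊎ retract z ≡ d)
    disjoint (inj₁ za) (inj₁ zc) = distinct ac (trans (≡-sym za) zc)
    disjoint (inj₁ za) (inj₂ zd) = distinct (<-trans ac (<-trans cb bd)) (trans (≡-sym za) zd)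
    disjoint (inj₂ zb) (inj₁ zc) = distinct cb (trans (≡-sym zc) zb)
    disjoint (inj₂ zb) (inj₂ zd) = distinct bd (trans (≡-sym zb) zd)

  contract-outerplanar : Injective _≡_ _≡_ f → Outerplanar G → Outerplanar contracted
  contract-outerplanar f-injective (σ , σ-injective , noncrossing) =
    noncrossing⇒outerplanar {G = contracted} (f-injective ∘ σ-injective ∘ toℕ-injective)
      (contract-noncrossing (σ-injective ∘ toℕ-injective) noncrossing)

contraction-completion : ∀ {D n m} {G G' : Graph n} {H : Graph m} {f : Fin m → Fin n} →
  DiamCompletion D G G' → SubgraphVia H G f → (ρ : Retraction G' f) →
  DiamCompletion D H (Contraction.contracted ρ)
contraction-completion {G' = G'} {H} {f} ((G⊆G' , outerplanar) , diameter) (f-injective , H⊆G) ρ =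
  (H⊆contracted , contract-outerplanar f-injective outerplanar) ,
  λ a b → reach-between-images (diameter (f a) (f b))
  where
  open Retraction ρ
  open Contraction ρ
  H⊆contracted : ∀ a b → Edge H a b → Edge contracted a b
  H⊆contracted a b e = contract-edge G' retract
    (edge-irrefl H e , f a , f b , retract-section a , retract-section b , G⊆G' _ _ (H⊆G a b e))

lemma1 : (D : ℕ) → .{{_ : NonZero D}} → ∀ {n m} (G : Graph n) (H : Graph m)
           (f : Fin m → Fin n) (v : Fin n) (v' : Fin m) →
           Connected G → Outerplanar G → Connected H →
           SubgraphVia H G f → f v' ≡ v →
           (eH eG : Maybe ℕ) → IsEccStar D H v' eH → IsEccStar D G v eG →
           eH ≤∞ eG
lemma1 _ _ _ _ _ _ _ _ _ _ _ eH nothing _ _ = eH ≤inf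
lemma1 D G H f _ v' _ _ _ embedding@(f-injective , _) refl eH (just k) eccH
       ((G' , completion@(_ , diameter) , (eccG' , _)) , _) =
  ecc*-≤-completion eccH (contraction-completion {G = G} {H = H} completion embedding ρ)
    λ w → reach-between-images (eccG' (f w))
  where
  ρ : Retraction G' f
  ρ = retraction f-injective λ x → v' , diameter x (f v')
  open Contraction ρ
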